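{- Let $m$ be a positive integer and $\alpha\in\{0,1,\dots,m-1\}$, and let $\zeta$ be a root of unity of order $M$. Define $$\psi(n)=\zeta^{\frac{n^2-(2m-2\alpha-1)^2}{8(2m+1)}}\chi^{(\alpha)}_{8m+4}(n).$$ Then $\sum_{n=1}^{M(8m+4)}\psi(n)=0$.
   Context: $\chi^{(\alpha)}_{8m+4}:\mathbb{Z}\to\mathbb{C}$ is defined by: $\chi^{(\alpha)}_{8m+4}(n)=-1/2$ if $n\equiv 2m-2\alpha-1$ or $6m+2\alpha+5\pmod{8m+4}$; $=1/2$ if $n\equiv 2m+2\alpha+3$ or $6m-2\alpha+1\pmod{8m+4}$; $=0$ otherwise. (On its support the exponent $\frac{n^2-(2m-2\alpha-1)^2}{8(2m+1)}$ is an integer.) -}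

module Defs where

open import Level using (Level; _⊔_)
open import Data.Nat as ℕ using (ℕ; zero; suc; _∸_; NonZero)
open import Data.Nat.DivMod using (_/_; _%_)
open import Data.Product using (∃)
open import Relation.Nullary using (¬_; yes; no)
open import Algebra.Bundles using (CommutativeRing)

modulus : ℕ → ℕ
modulus m = suc (8 ℕ.* m ℕ.+ 3)

rA rA' rB rB' : ℕ → ℕ → ℕ
rA  m α = 2 ℕ.* m ∸ 2 ℕ.* α ∸ 1
rA' m α = 6 ℕ.* m ℕ.+ 2 ℕ.* α ℕ.+ 5
rB  m α = 2 ℕ.* m ℕ.+ 2 ℕ.* α ℕ.+ 3
rB' m α = 6 ℕ.* m ∸ 2 ℕ.* α ℕ.+ 1

-- the exponent (n² - (2m-2α-1)²) / (8(2m+1)); on the support of χ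
-- this is a nonnegative integer, so truncated subtraction/division is exact there.
expo : ℕ → ℕ → ℕ → ℕ
expo m α n = (n ℕ.* n ∸ rA m α ℕ.* rA m α) / suc (16 ℕ.* m ℕ.+ 7)   -- 8(2m+1) = 16m+8

module _ {c ℓ : Level} (R : CommutativeRing c ℓ) where
  open CommutativeRing R

  pow : Carrier → ℕ → Carrier
  pow x zero    = 1#
  pow x (suc k) = x * pow x k

  natR : ℕ → Carrier
  natR zero    = 0#
  natR (suc k) = 1# + natR k

  CharZero : Set ℓ
  CharZero = ∀ k → ¬ (natR (suc k) ≈ 0#)

  IsField : Set (c ⊔ ℓ)
  IsField = ∀ x → ¬ (x ≈ 0#) → ∃ λ y → x * y ≈ 1#

  RootOfUnityOfOrder : Carrier → ℕ → Set ℓ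
  RootOfUnityOfOrder ζ M =
    (0 ℕ.< M) × (pow ζ M ≈ 1#) × (∀ d → 0 ℕ.< d → d ℕ.< M → ¬ (pow ζ d ≈ 1#))
    where open import Data.Product using (_×_)

  -- χ^{(α)}_{8m+4}(n) with values in R; h is 1/2 (h * 2 = 1)
  chi : (h : Carrier) → ℕ → ℕ → ℕ → Carrier
  chi h m α n with n % modulus m
  ... | r with r ℕ.≟ rA m α % modulus m | r ℕ.≟ rA' m α % modulus m
  ...   | yes _ | _     = - h
  ...   | no _  | yes _ = - h
  ...   | no _  | no _ with r ℕ.≟ rB m α % modulus m | r ℕ.≟ rB' m α % modulus m
  ...     | yes _ | _     = h
  ...     | no _  | yes _ = h
  ...     | no _  | no _  = 0#

  psi : (h ζ : Carrier) → ℕ → ℕ → ℕ → Carrier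
  psi h ζ m α n = pow ζ (expo m α n) * chi h m α n

  sum1to : (ℕ → Carrier) → ℕ → Carrier
  sum1to f zero    = 0#
  sum1to f (suc K) = sum1to f K + f (suc K)

-- Write m = α + a + 1, N = 8m+4 and H = 4m+2, so N = 2H.  The support of
-- χ = χ^{(α)}_{8m+4} consists of the residues
--   c₁ = 2m-2α-1 = 2a+1 and c₃ = 2m+2α+3      (where χ = -h and χ = h),
--   c₁+H = 6m-2α+1 and c₃+H = 6m+2α+5         (where χ = h and χ = -h),
-- with c₁ < c₃ < H.  Hence χ is N-periodic and H-antiperiodic: χ(n+H) = -χ(n).
-- Every n in the support is odd and ≥ c₁; for such n the exponent satisfies
-- e(n + MH) = e(n) + t, where t is an odd multiple of M/2 when M is even
-- (and ζ^{M/2} = -1 because ζ has order M in a field), and a multiple of M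
-- when M is odd.  In both cases ψ(MH + n) = -ψ(n), and a function which is
-- antiperiodic with half period P = MH sums to zero over 1..2P = M·N.
module Submission where

open import Defs
open import Level using (Level)
open import Data.Nat using (ℕ; _<_; _*_)
open import Algebra.Bundles using (CommutativeRing)

open import Data.Nat using (zero; suc; _+_; _∸_; _≤_; z≤n; s≤s; _≟_)
open import Data.Nat.Properties
  using (m<m+n; <-trans; <-irrefl; <-≤-trans; <⇒≤; <⇒≢; ≤-refl; ≤-trans; m≤m+n; m≤n+m;
         m+n∸m≡n; +-suc; +-∸-comm; *-mono-≤; m≤n⇒∃[o]m+o≡n)
import Data.Nat.Properties as ℕₚ
open import Data.Nat.DivMod
open import Data.Nat.Divisibility using (divides)
open import Data.Nat.Tactic.RingSolver using (solve-∀)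
open import Data.Product using (∃; _×_; _,_; proj₁; proj₂)
open import Data.Sum using (_⊎_; inj₁; inj₂)
open import Data.Empty using (⊥-elim)
open import Relation.Nullary using (¬_; yes; no)
open import Relation.Binary.PropositionalEquality
  using (_≡_; _≢_; refl; sym; trans; cong; cong₂; subst; module ≡-Reasoning)

data EvenOdd : ℕ → Set where
  even : ∀ u → EvenOdd (u + u)
  odd  : ∀ u → EvenOdd (suc (u + u))

evenOdd : ∀ n → EvenOdd n
evenOdd zero = even zero
evenOdd (suc n) with evenOdd n
... | even u = odd u
... | odd u  = subst EvenOdd (cong suc (+-suc u u)) (even (suc u))

module RingFacts {c ℓ : Level} (R : CommutativeRing c ℓ) where
  open CommutativeRing R
    renaming (_+_ to _⊕_; _*_ to _⊗_; refl to ≈-refl; sym to ≈-sym; trans to ≈-trans)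
  open import Algebra.Properties.Ring ring
    using (-0#≈0#; -‿injective; +-inverseʳ-unique; -‿+-comm;
           -‿distribˡ-*; -‿distribʳ-*; [y-z]x≈yx-zx)
  open import Relation.Binary.Reasoning.Setoid setoid

  pow-+ : ∀ z p q → pow R z (p + q) ≈ pow R z p ⊗ pow R z q
  pow-+ z zero    q = ≈-sym (*-identityˡ _)
  pow-+ z (suc p) q = ≈-trans (*-congˡ (pow-+ z p q)) (≈-sym (*-assoc _ _ _))

  pow-multiple : ∀ z M → pow R z M ≈ 1# → ∀ w → pow R z (w * M) ≈ 1#
  pow-multiple z M zᴹ≈1 zero    = ≈-refl
  pow-multiple z M zᴹ≈1 (suc w) = begin
    pow R z (M + w * M)          ≈⟨ pow-+ z M (w * M) ⟩
    pow R z M ⊗ pow R z (w * M)  ≈⟨ *-cong zᴹ≈1 (pow-multiple z M zᴹ≈1 w) ⟩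
    1# ⊗ 1#                      ≈⟨ *-identityˡ 1# ⟩
    1#                           ∎

  pow-odd-multiple : ∀ z u → pow R z u ≈ - 1# → pow R z (u + u) ≈ 1# →
                     ∀ w → pow R z (u + w * (u + u)) ≈ - 1#
  pow-odd-multiple z u zᵘ≈-1 z²ᵘ≈1 w = begin
    pow R z (u + w * (u + u))          ≈⟨ pow-+ z u (w * (u + u)) ⟩
    pow R z u ⊗ pow R z (w * (u + u))  ≈⟨ *-cong zᵘ≈-1 (pow-multiple z (u + u) z²ᵘ≈1 w) ⟩
    - 1# ⊗ 1#                          ≈⟨ *-identityʳ (- 1#) ⟩
    - 1#                               ∎

  pow-shift-by-one : ∀ z e t → pow R z t ≈ 1# → pow R z (e + t) ≈ pow R z e
  pow-shift-by-one z e t zᵗ≈1 = begin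
    pow R z (e + t)          ≈⟨ pow-+ z e t ⟩
    pow R z e ⊗ pow R z t    ≈⟨ *-congˡ zᵗ≈1 ⟩
    pow R z e ⊗ 1#           ≈⟨ *-identityʳ _ ⟩
    pow R z e                ∎

  pow-shift-by-minus-one : ∀ z e t → pow R z t ≈ - 1# → pow R z (e + t) ≈ - pow R z e
  pow-shift-by-minus-one z e t zᵗ≈-1 = begin
    pow R z (e + t)          ≈⟨ pow-+ z e t ⟩
    pow R z e ⊗ pow R z t    ≈⟨ *-congˡ zᵗ≈-1 ⟩
    pow R z e ⊗ - 1#         ≈⟨ -‿distribʳ-* _ 1# ⟨
    - (pow R z e ⊗ 1#)       ≈⟨ -‿cong (*-identityʳ _) ⟩
    - pow R z e              ∎

  sum-split : ∀ f P b → sum1to R f (P + b) ≈ sum1to R f P ⊕ sum1to R (λ i → f (P + i)) b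
  sum-split f P zero    rewrite ℕₚ.+-identityʳ P = ≈-sym (+-identityʳ _)
  sum-split f P (suc b) rewrite +-suc P b = ≈-trans (+-congʳ (sum-split f P b)) (+-assoc _ _ _)

  antiperiodic-sum : ∀ f P → (∀ n → f (P + n) ≈ - f n) → sum1to R f (P + P) ≈ 0#
  antiperiodic-sum f P f-anti = begin
    sum1to R f (P + P)                            ≈⟨ sum-split f P P ⟩
    sum1to R f P ⊕ sum1to R (λ i → f (P + i)) P   ≈⟨ +-congˡ (shifted-sum P) ⟩
    sum1to R f P ⊕ - sum1to R f P                 ≈⟨ -‿inverseʳ _ ⟩
    0#                                            ∎
    where
    shifted-sum : ∀ b → sum1to R (λ i → f (P + i)) b ≈ - sum1to R f b
    shifted-sum zero    = ≈-sym -0#≈0#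
    shifted-sum (suc b) = ≈-trans (+-cong (shifted-sum b) (f-anti (suc b))) (-‿+-comm _ _)

  -- Signs pass through products: these three cases cover the comparison of
  -- ψ(n + MH) = ζ^{e'} χ' with ψ(n) = ζ^e χ.
  neg-left : ∀ {a a′ b b′} → a′ ≈ - a → b′ ≈ b → a′ ⊗ b′ ≈ - (a ⊗ b)
  neg-left a′≈-a b′≈b = ≈-trans (*-cong a′≈-a b′≈b) (≈-sym (-‿distribˡ-* _ _))

  neg-right : ∀ {a a′ b b′} → a′ ≈ a → b′ ≈ - b → a′ ⊗ b′ ≈ - (a ⊗ b)
  neg-right a′≈a b′≈-b = ≈-trans (*-cong a′≈a b′≈-b) (≈-sym (-‿distribʳ-* _ _))

  neg-zero : ∀ {a a′ b b′} → b ≈ 0# → b′ ≈ 0# → a′ ⊗ b′ ≈ - (a ⊗ b)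
  neg-zero {a} {a′} {b} {b′} b≈0 b′≈0 = begin
    a′ ⊗ b′     ≈⟨ *-congˡ b′≈0 ⟩
    a′ ⊗ 0#     ≈⟨ zeroʳ a′ ⟩
    0#          ≈⟨ -0#≈0# ⟨
    - 0#        ≈⟨ -‿cong (zeroʳ a) ⟨
    - (a ⊗ 0#)  ≈⟨ -‿cong (*-congˡ b≈0) ⟨
    - (a ⊗ b)   ∎

  cancel-nonzero : IsField R → ∀ x y → ¬ (x ≈ 0#) → x ⊗ y ≈ 0# → y ≈ 0#
  cancel-nonzero isField x y x≉0 xy≈0 with isField x x≉0
  ... | x⁻¹ , xx⁻¹≈1 = begin
    y                ≈⟨ *-identityˡ y ⟨
    1# ⊗ y           ≈⟨ *-congʳ (≈-trans (*-comm x⁻¹ x) xx⁻¹≈1) ⟨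
    (x⁻¹ ⊗ x) ⊗ y    ≈⟨ *-assoc x⁻¹ x y ⟩
    x⁻¹ ⊗ (x ⊗ y)    ≈⟨ *-congˡ xy≈0 ⟩
    x⁻¹ ⊗ 0#         ≈⟨ zeroʳ x⁻¹ ⟩
    0#               ∎

  -- In a field the only square roots of unity are 1 and -1,
  -- since y² - 1 = (y - 1)(y + 1).
  square-root-of-unity : IsField R → ∀ y → y ⊗ y ≈ 1# → ¬ (y ≈ 1#) → y ≈ - 1#
  square-root-of-unity isField y y²≈1 y≉1 =
    +-inverseʳ-unique 1# y (≈-trans (+-comm 1# y) (cancel-nonzero isField (y - 1#) (y ⊕ 1#) y-1≉0 factored))
    where
    y-1≉0 : ¬ (y - 1# ≈ 0#)
    y-1≉0 y-1≈0 = y≉1 (≈-sym (-‿injective (+-inverseʳ-unique y (- 1#) y-1≈0)))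
    factored : (y - 1#) ⊗ (y ⊕ 1#) ≈ 0#
    factored = begin
      (y - 1#) ⊗ (y ⊕ 1#)                   ≈⟨ [y-z]x≈yx-zx (y ⊕ 1#) y 1# ⟩
      y ⊗ (y ⊕ 1#) - 1# ⊗ (y ⊕ 1#)          ≈⟨ +-cong (distribˡ y y 1#) (-‿cong (*-identityˡ _)) ⟩
      (y ⊗ y ⊕ y ⊗ 1#) - (y ⊕ 1#)           ≈⟨ +-congʳ (+-cong y²≈1 (*-identityʳ y)) ⟩
      (1# ⊕ y) - (y ⊕ 1#)                   ≈⟨ +-congʳ (+-comm 1# y) ⟩
      (y ⊕ 1#) - (y ⊕ 1#)                   ≈⟨ -‿inverseʳ _ ⟩
      0#                                    ∎

  half-order-power : IsField R → ∀ ζ u → 0 < u → RootOfUnityOfOrder R ζ (u + u) →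
                     pow R ζ u ≈ - 1#
  half-order-power isField ζ u 0<u (_ , ζ²ᵘ≈1 , ζ-exact) =
    square-root-of-unity isField (pow R ζ u) (≈-trans (≈-sym (pow-+ ζ u u)) ζ²ᵘ≈1)
      (ζ-exact u 0<u (m<m+n u 0<u))

module Residues (α a : ℕ) where
  m N H c₁ c₃ : ℕ
  m  = suc (α + a)
  N  = modulus m
  H  = 4 * m + 2
  c₁ = 1 + 2 * a
  c₃ = 4 * α + 2 * a + 5

  N≡H+H : N ≡ H + H
  N≡H+H = identity m
    where
    identity : ∀ m → suc (8 * m + 3) ≡ (4 * m + 2) + (4 * m + 2)
    identity = solve-∀

  c₁<c₃ : c₁ < c₃
  c₁<c₃ = subst (c₁ <_) (identity α a) (m<m+n c₁ (s≤s z≤n))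
    where
    identity : ∀ α a → 1 + 2 * a + suc (4 * α + 3) ≡ 4 * α + 2 * a + 5
    identity = solve-∀

  c₃<H : c₃ < H
  c₃<H = subst (c₃ <_) (identity α a) (m<m+n c₃ (s≤s z≤n))
    where
    identity : ∀ α a → 4 * α + 2 * a + 5 + suc (2 * a) ≡ 4 * suc (α + a) + 2
    identity = solve-∀

  c₁<H : c₁ < H
  c₁<H = <-trans c₁<c₃ c₃<H

  low≢high : ∀ {c} d → c < H → c ≢ d + H
  low≢high d c<H = <⇒≢ (<-≤-trans c<H (m≤n+m H d))

  high<N : ∀ {c} → c < H → c + H < N
  high<N {c} c<H = subst (c + H <_) (sym N≡H+H) (ℕₚ.+-monoˡ-< H c<H)

  low<N : ∀ {c} → c < H → c < N
  low<N {c} c<H = ℕₚ.≤-<-trans (m≤m+n c H) (high<N c<H)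

  rA-value : rA m α ≡ c₁
  rA-value = begin
    2 * m ∸ 2 * α ∸ 1                 ≡⟨ cong (λ k → k ∸ 2 * α ∸ 1) (double-m α a) ⟩
    2 * α + (2 + 2 * a) ∸ 2 * α ∸ 1   ≡⟨ cong (_∸ 1) (m+n∸m≡n (2 * α) (2 + 2 * a)) ⟩
    c₁                                ∎
    where
    open ≡-Reasoning
    double-m : ∀ α a → 2 * suc (α + a) ≡ 2 * α + (2 + 2 * a)
    double-m = solve-∀

  rA≡c₁ : rA m α % N ≡ c₁
  rA≡c₁ = trans (cong (_% N) rA-value) (m<n⇒m%n≡m (low<N c₁<H))

  rB≡c₃ : rB m α % N ≡ c₃
  rB≡c₃ = trans (cong (_% N) (rB-value α a)) (m<n⇒m%n≡m (low<N c₃<H))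
    where
    rB-value : ∀ α a → 2 * suc (α + a) + 2 * α + 3 ≡ 4 * α + 2 * a + 5
    rB-value = solve-∀

  rA′≡c₃+H : rA' m α % N ≡ c₃ + H
  rA′≡c₃+H = trans (cong (_% N) (rA′-value α a)) (m<n⇒m%n≡m (high<N c₃<H))
    where
    rA′-value : ∀ α a → 6 * suc (α + a) + 2 * α + 5 ≡ 4 * α + 2 * a + 5 + (4 * suc (α + a) + 2)
    rA′-value = solve-∀

  rB′≡c₁+H : rB' m α % N ≡ c₁ + H
  rB′≡c₁+H = trans (cong (_% N) rB′-value) (m<n⇒m%n≡m (high<N c₁<H))
    where
    open ≡-Reasoning
    six-m : ∀ α a → 6 * suc (α + a) ≡ 2 * α + (4 * α + 6 * a + 6)
    six-m = solve-∀
    regroup : ∀ α a → 4 * α + 6 * a + 6 + 1 ≡ 1 + 2 * a + (4 * suc (α + a) + 2)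
    regroup = solve-∀
    rB′-value : rB' m α ≡ c₁ + H
    rB′-value = begin
      6 * m ∸ 2 * α + 1                           ≡⟨ cong (λ k → k ∸ 2 * α + 1) (six-m α a) ⟩
      2 * α + (4 * α + 6 * a + 6) ∸ 2 * α + 1     ≡⟨ cong (_+ 1) (m+n∸m≡n (2 * α) _) ⟩
      4 * α + 6 * a + 6 + 1                       ≡⟨ regroup α a ⟩
      c₁ + H                                      ∎

  halfTurn : ℕ → ℕ
  halfTurn r = (r + H) % N

  H%N≡H : H % N ≡ H
  H%N≡H = m<n⇒m%n≡m (subst (H <_) (sym N≡H+H) (m<m+n H 0<H))
    where
    0<H : 0 < H
    0<H = <-≤-trans (s≤s z≤n) (m≤n+m 2 (4 * m))

  halfTurn-residue : ∀ n → (n + H) % N ≡ halfTurn (n % N)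
  halfTurn-residue n = begin
    (n + H) % N             ≡⟨ %-distribˡ-+ n H N ⟩
    (n % N + H % N) % N     ≡⟨ cong (λ k → (n % N + k) % N) H%N≡H ⟩
    halfTurn (n % N)        ∎
    where open ≡-Reasoning

  twice-H : ∀ r → (r + H + H) % N ≡ r % N
  twice-H r = trans (cong (_% N) (trans (ℕₚ.+-assoc r H H) (cong (r +_) (sym N≡H+H))))
                    ([m+n]%n≡m%n r N)

  halfTurn-low : ∀ {c} → c < H → halfTurn c ≡ c + H
  halfTurn-low c<H = m<n⇒m%n≡m (high<N c<H)

  halfTurn-high : ∀ {c} → c < H → halfTurn (c + H) ≡ c
  halfTurn-high {c} c<H = trans (twice-H c) (m<n⇒m%n≡m (low<N c<H))

  halfTurn-involutive : ∀ {r} → r < N → halfTurn (halfTurn r) ≡ r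
  halfTurn-involutive {r} r<N = begin
    ((r + H) % N + H) % N       ≡⟨ cong (λ k → ((r + H) % N + k) % N) H%N≡H ⟨
    ((r + H) % N + H % N) % N   ≡⟨ %-distribˡ-+ (r + H) H N ⟨
    (r + H + H) % N             ≡⟨ twice-H r ⟩
    r % N                       ≡⟨ m<n⇒m%n≡m r<N ⟩
    r                           ∎
    where open ≡-Reasoning

  turned : ∀ n {d d′} → n % N ≡ d → halfTurn d ≡ d′ → (n + H) % N ≡ d′
  turned n n%N≡d turn≡d′ = trans (halfTurn-residue n) (trans (cong halfTurn n%N≡d) turn≡d′)

  unturned : ∀ n {d d′} → (n + H) % N ≡ d → halfTurn d ≡ d′ → n % N ≡ d′
  unturned n {d} {d′} [n+H]%N≡d turn≡d′ = begin
    n % N                        ≡⟨ halfTurn-involutive (m%n<n n N) ⟨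
    halfTurn (halfTurn (n % N))  ≡⟨ cong halfTurn (trans (sym (halfTurn-residue n)) [n+H]%N≡d) ⟩
    halfTurn d                   ≡⟨ turn≡d′ ⟩
    d′                           ∎
    where open ≡-Reasoning

  data ResidueView (r : ℕ) : Set where
    at-c₁     : r ≡ c₁ → ResidueView r
    at-c₃     : r ≡ c₃ → ResidueView r
    at-c₁+H   : r ≡ c₁ + H → ResidueView r
    at-c₃+H   : r ≡ c₃ + H → ResidueView r
    elsewhere : r ≢ c₁ → r ≢ c₃ → r ≢ c₁ + H → r ≢ c₃ + H → ResidueView r

  residueView : ∀ r → ResidueView r
  residueView r with r ≟ c₁ | r ≟ c₃ | r ≟ c₁ + H | r ≟ c₃ + H
  ... | yes e | _     | _      | _      = at-c₁ e
  ... | no _  | yes e | _      | _      = at-c₃ e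
  ... | no _  | no _  | yes e  | _      = at-c₁+H e
  ... | no _  | no _  | no _   | yes e  = at-c₃+H e
  ... | no ≢₁ | no ≢₃ | no ≢₁′ | no ≢₃′ = elsewhere ≢₁ ≢₃ ≢₁′ ≢₃′

  -- n is odd and at least c₁: then n² - c₁² is a genuine difference of squares.
  OddAbove : ℕ → Set
  OddAbove n = (∃ λ k → n ≡ 1 + 2 * k) × c₁ ≤ n

  -- Since N is even, an odd residue at least c₁ forces n itself to be odd and ≥ c₁.
  odd-residue : ∀ n {r} e → n % N ≡ r → r ≡ 1 + 2 * e → c₁ ≤ r → OddAbove n
  odd-residue n {r} e n%N≡r r≡1+2e c₁≤r =
    (e + (n / N) * H , n≡1+2k) , ≤-trans c₁≤r (subst (_≤ n) n%N≡r (m%n≤m n N))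
    where
    open ≡-Reasoning
    regroup : ∀ e j H → 1 + 2 * e + j * (H + H) ≡ 1 + 2 * (e + j * H)
    regroup = solve-∀
    n≡1+2k : n ≡ 1 + 2 * (e + (n / N) * H)
    n≡1+2k = begin
      n                               ≡⟨ m≡m%n+[m/n]*n n N ⟩
      n % N + (n / N) * N             ≡⟨ cong₂ (λ x y → x + (n / N) * y) (trans n%N≡r r≡1+2e) N≡H+H ⟩
      1 + 2 * e + (n / N) * (H + H)   ≡⟨ regroup e (n / N) H ⟩
      1 + 2 * (e + (n / N) * H)       ∎

  support-odd-above : ∀ n {r} → n % N ≡ r →
                      (r ≡ c₁ ⊎ r ≡ c₃) ⊎ (r ≡ c₁ + H ⊎ r ≡ c₃ + H) → OddAbove n
  support-odd-above n e (inj₁ (inj₁ refl)) = odd-residue n a e refl ≤-refl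
  support-odd-above n e (inj₁ (inj₂ refl)) = odd-residue n (2 * α + a + 2) e (c₃-odd α a) (<⇒≤ c₁<c₃)
    where
    c₃-odd : ∀ α a → 4 * α + 2 * a + 5 ≡ 1 + 2 * (2 * α + a + 2)
    c₃-odd = solve-∀
  support-odd-above n e (inj₂ (inj₁ refl)) = odd-residue n (a + 2 * m + 1) e (c₁+H-odd a m) (m≤m+n c₁ H)
    where
    c₁+H-odd : ∀ a m → 1 + 2 * a + (4 * m + 2) ≡ 1 + 2 * (a + 2 * m + 1)
    c₁+H-odd = solve-∀
  support-odd-above n e (inj₂ (inj₂ refl)) =
    odd-residue n (2 * α + a + 2 * m + 3) e (c₃+H-odd α a m) (≤-trans (<⇒≤ c₁<c₃) (m≤m+n c₃ H))
    where
    c₃+H-odd : ∀ α a m → 4 * α + 2 * a + 5 + (4 * m + 2) ≡ 1 + 2 * (2 * α + a + 2 * m + 3)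
    c₃+H-odd = solve-∀

  Q : ℕ
  Q = suc (16 * m + 7)

  expo-shift : ∀ P n t → c₁ ≤ n → (P + n) * (P + n) ≡ n * n + Q * t →
               expo m α (P + n) ≡ expo m α n + t
  expo-shift P n t c₁≤n square = begin
    ((P + n) * (P + n) ∸ rA m α * rA m α) / Q  ≡⟨ cong₂ (λ u v → (u ∸ v * v) / Q) square rA-value ⟩
    (n * n + Q * t ∸ c₁ * c₁) / Q              ≡⟨ cong (_/ Q) (+-∸-comm (Q * t) (*-mono-≤ c₁≤n c₁≤n)) ⟩
    ((n * n ∸ c₁ * c₁) + Q * t) / Q            ≡⟨ +-distrib-/-∣ʳ (n * n ∸ c₁ * c₁) (divides t (ℕₚ.*-comm Q t)) ⟩
    (n * n ∸ c₁ * c₁) / Q + (Q * t) / Q        ≡⟨ cong₂ (λ u v → (n * n ∸ u * u) / Q + v) (sym rA-value) Qt/Q≡t ⟩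
    (n * n ∸ rA m α * rA m α) / Q + t          ∎
    where
    open ≡-Reasoning
    Qt/Q≡t : (Q * t) / Q ≡ t
    Qt/Q≡t = trans (cong (_/ Q) (ℕₚ.*-comm Q t)) (m*n/n≡m t Q)

  expo-shift-even : ∀ u n → OddAbove n →
                    ∃ λ w → expo m α ((u + u) * H + n) ≡ expo m α n + (u + w * (u + u))
  expo-shift-even u n ((k , refl) , c₁≤n) =
    k + (2 * m + 1) * u , expo-shift ((u + u) * H) n _ c₁≤n (square u k m)
    where
    square : ∀ u k m → ((u + u) * (4 * m + 2) + (1 + 2 * k)) * ((u + u) * (4 * m + 2) + (1 + 2 * k))
             ≡ (1 + 2 * k) * (1 + 2 * k) + suc (16 * m + 7) * (u + (k + (2 * m + 1) * u) * (u + u))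
    square = solve-∀

  expo-shift-odd : ∀ u n → OddAbove n →
                   ∃ λ w → expo m α (suc (u + u) * H + n) ≡ expo m α n + w * suc (u + u)
  expo-shift-odd u n ((k , refl) , c₁≤n) =
    1 + k + 2 * m * u + m + u , expo-shift (suc (u + u) * H) n _ c₁≤n (square u k m)
    where
    square : ∀ u k m → (suc (u + u) * (4 * m + 2) + (1 + 2 * k)) * (suc (u + u) * (4 * m + 2) + (1 + 2 * k))
             ≡ (1 + 2 * k) * (1 + 2 * k) + suc (16 * m + 7) * ((1 + k + 2 * m * u + m + u) * suc (u + u))
    square = solve-∀

module Character {c ℓ : Level} (R : CommutativeRing c ℓ) (h : CommutativeRing.Carrier R) (α a : ℕ) where
  open Residues α a
  open CommutativeRing R using (Carrier; 0#; -_; _≈_; setoid)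
    renaming (sym to ≈-sym; trans to ≈-trans; reflexive to ≈-reflexive)
  open import Algebra.Properties.Ring (CommutativeRing.ring R) using (-0#≈0#; -‿involutive)

  χ : ℕ → Carrier
  χ = chi R h m α

  χ-cong : ∀ n n′ → n % N ≡ n′ % N → χ n ≡ χ n′
  χ-cong n n′ eq rewrite eq = refl

  χ-periodic : ∀ n u → χ (n + u * N) ≡ χ n
  χ-periodic n u = χ-cong (n + u * N) n ([m+kn]%n≡m%n n u N)

  private
    differ : ∀ {r c d X : ℕ} → r ≡ c → X ≡ d → c ≢ d → r ≢ X
    differ r≡c X≡d c≢d r≡X = c≢d (trans (sym r≡c) (trans r≡X X≡d))

    c₁≢c₃ : c₁ ≢ c₃
    c₁≢c₃ = <⇒≢ c₁<c₃

    c₁+H≢c₃+H : c₁ + H ≢ c₃ + H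
    c₁+H≢c₃+H eq = c₁≢c₃ (ℕₚ.+-cancelʳ-≡ H c₁ c₃ eq)

    high≢low : ∀ {c} d → c < H → d + H ≢ c
    high≢low d c<H eq = low≢high d c<H (sym eq)

  χ-c₁ : ∀ n → n % N ≡ c₁ → χ n ≡ - h
  χ-c₁ n e with n % N ≟ rA m α % N
  ... | yes _ = refl
  ... | no ≢₁ = ⊥-elim (≢₁ (trans e (sym rA≡c₁)))

  χ-c₃+H : ∀ n → n % N ≡ c₃ + H → χ n ≡ - h
  χ-c₃+H n e with n % N ≟ rA m α % N | n % N ≟ rA' m α % N
  ... | yes ≡₁ | _      = ⊥-elim (differ e rA≡c₁ (high≢low c₃ c₁<H) ≡₁)
  ... | no _   | yes _  = refl
  ... | no _   | no ≢₂  = ⊥-elim (≢₂ (trans e (sym rA′≡c₃+H)))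

  χ-c₃ : ∀ n → n % N ≡ c₃ → χ n ≡ h
  χ-c₃ n e with n % N ≟ rA m α % N | n % N ≟ rA' m α % N
  ... | yes ≡₁ | _      = ⊥-elim (differ e rA≡c₁ (λ eq → c₁≢c₃ (sym eq)) ≡₁)
  ... | no _   | yes ≡₂ = ⊥-elim (differ e rA′≡c₃+H (low≢high c₃ c₃<H) ≡₂)
  ... | no _   | no _ with n % N ≟ rB m α % N
  ...   | yes _ = refl
  ...   | no ≢₃ = ⊥-elim (≢₃ (trans e (sym rB≡c₃)))

  χ-c₁+H : ∀ n → n % N ≡ c₁ + H → χ n ≡ h
  χ-c₁+H n e with n % N ≟ rA m α % N | n % N ≟ rA' m α % N
  ... | yes ≡₁ | _      = ⊥-elim (differ e rA≡c₁ (high≢low c₁ c₁<H) ≡₁)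
  ... | no _   | yes ≡₂ = ⊥-elim (differ e rA′≡c₃+H c₁+H≢c₃+H ≡₂)
  ... | no _   | no _ with n % N ≟ rB m α % N | n % N ≟ rB' m α % N
  ...   | yes ≡₃ | _     = ⊥-elim (differ e rB≡c₃ (high≢low c₁ c₃<H) ≡₃)
  ...   | no _   | yes _ = refl
  ...   | no _   | no ≢₄ = ⊥-elim (≢₄ (trans e (sym rB′≡c₁+H)))

  χ-elsewhere : ∀ n → n % N ≢ c₁ → n % N ≢ c₃ → n % N ≢ c₁ + H → n % N ≢ c₃ + H → χ n ≡ 0#
  χ-elsewhere n ≢₁ ≢₃ ≢₁′ ≢₃′ with n % N ≟ rA m α % N | n % N ≟ rA' m α % N
  ... | yes ≡₁ | _      = ⊥-elim (≢₁ (trans ≡₁ rA≡c₁))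
  ... | no _   | yes ≡₂ = ⊥-elim (≢₃′ (trans ≡₂ rA′≡c₃+H))
  ... | no _   | no _ with n % N ≟ rB m α % N | n % N ≟ rB' m α % N
  ...   | yes ≡₃ | _      = ⊥-elim (≢₃ (trans ≡₃ rB≡c₃))
  ...   | no _   | yes ≡₄ = ⊥-elim (≢₁′ (trans ≡₄ rB′≡c₁+H))
  ...   | no _   | no _   = refl

  private
    opposite : ∀ {x y v} → x ≡ - v → y ≡ v → x ≈ - y
    opposite x≡-v y≡v = ≈-reflexive (trans x≡-v (cong -_ (sym y≡v)))

    opposite′ : ∀ {x y v} → x ≡ v → y ≡ - v → x ≈ - y
    opposite′ {x} {y} {v} x≡v y≡-v = begin
      x        ≡⟨ x≡v ⟩
      v        ≈⟨ -‿involutive v ⟨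
      - (- v)  ≡⟨ cong -_ y≡-v ⟨
      - y      ∎
      where open import Relation.Binary.Reasoning.Setoid setoid

  -- χ is antiperiodic with half period H: the half turn swaps c₁ ↔ c₁ + H and
  -- c₃ ↔ c₃ + H, on which χ takes opposite values, and preserves the complement.
  χ-antiperiodic : ∀ n → χ (n + H) ≈ - χ n
  χ-antiperiodic n with residueView (n % N)
  ... | at-c₁ e   = opposite′ (χ-c₁+H (n + H) (turned n e (halfTurn-low c₁<H))) (χ-c₁ n e)
  ... | at-c₃ e   = opposite (χ-c₃+H (n + H) (turned n e (halfTurn-low c₃<H))) (χ-c₃ n e)
  ... | at-c₁+H e = opposite (χ-c₁ (n + H) (turned n e (halfTurn-high c₁<H))) (χ-c₁+H n e)
  ... | at-c₃+H e = opposite′ (χ-c₃ (n + H) (turned n e (halfTurn-high c₃<H))) (χ-c₃+H n e)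
  ... | elsewhere ≢₁ ≢₃ ≢₁′ ≢₃′ =
    ≈-trans (≈-reflexive χ[n+H]≡0) (≈-trans (≈-sym -0#≈0#) (≈-reflexive (cong -_ (sym χn≡0))))
    where
    χn≡0 : χ n ≡ 0#
    χn≡0 = χ-elsewhere n ≢₁ ≢₃ ≢₁′ ≢₃′
    χ[n+H]≡0 : χ (n + H) ≡ 0#
    χ[n+H]≡0 = χ-elsewhere (n + H)
      (λ e → ≢₁′ (unturned n e (halfTurn-low c₁<H)))
      (λ e → ≢₃′ (unturned n e (halfTurn-low c₃<H)))
      (λ e → ≢₁ (unturned n e (halfTurn-high c₁<H)))
      (λ e → ≢₃ (unturned n e (halfTurn-high c₃<H)))

  χ-shift-even : ∀ u n → χ ((u + u) * H + n) ≡ χ n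
  χ-shift-even u n = trans (cong χ (trans (regroup u n H) (cong (λ k → n + u * k) (sym N≡H+H))))
                           (χ-periodic n u)
    where
    regroup : ∀ u n H → (u + u) * H + n ≡ n + u * (H + H)
    regroup = solve-∀

  χ-shift-odd : ∀ u n → χ (suc (u + u) * H + n) ≈ - χ n
  χ-shift-odd u n =
    ≈-trans (≈-reflexive (trans (cong χ shifted) (χ-periodic (n + H) u))) (χ-antiperiodic n)
    where
    regroup : ∀ u n H → suc (u + u) * H + n ≡ n + H + u * (H + H)
    regroup = solve-∀
    shifted : suc (u + u) * H + n ≡ n + H + u * N
    shifted = trans (regroup u n H) (cong (λ k → n + H + u * k) (sym N≡H+H))

  support-or-zero : ∀ n → χ n ≡ 0# ⊎ OddAbove n
  support-or-zero n with residueView (n % N)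
  ... | at-c₁ e   = inj₂ (support-odd-above n e (inj₁ (inj₁ refl)))
  ... | at-c₃ e   = inj₂ (support-odd-above n e (inj₁ (inj₂ refl)))
  ... | at-c₁+H e = inj₂ (support-odd-above n e (inj₂ (inj₁ refl)))
  ... | at-c₃+H e = inj₂ (support-odd-above n e (inj₂ (inj₂ refl)))
  ... | elsewhere ≢₁ ≢₃ ≢₁′ ≢₃′ = inj₁ (χ-elsewhere n ≢₁ ≢₃ ≢₁′ ≢₃′)

module Summand {c ℓ : Level} (R : CommutativeRing c ℓ) (ζ h : CommutativeRing.Carrier R) (α a : ℕ) where
  open Residues α a
  open Character R h α a
  open RingFacts R
  open CommutativeRing R using (1#; -_; _≈_; -‿cong)
    renaming (reflexive to ≈-reflexive; trans to ≈-trans)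
  open import Algebra.Properties.Ring (CommutativeRing.ring R) using (-0#≈0#)

  ψ : ℕ → CommutativeRing.Carrier R
  ψ = psi R h ζ m α

  -- For M = 2u with ζ^u = -1: χ is unchanged and the power of ζ changes sign.
  ψ-antiperiodic-even : ∀ u → pow R ζ u ≈ - 1# → pow R ζ (u + u) ≈ 1# →
                        ∀ n → ψ ((u + u) * H + n) ≈ - ψ n
  ψ-antiperiodic-even u ζᵘ≈-1 ζ²ᵘ≈1 n with support-or-zero n
  ... | inj₁ χn≡0 = neg-zero (≈-reflexive χn≡0) (≈-reflexive (trans (χ-shift-even u n) χn≡0))
  ... | inj₂ n-odd with expo-shift-even u n n-odd
  ...   | w , expo≡ = neg-left power-flips (≈-reflexive (χ-shift-even u n))
    where
    power-flips : pow R ζ (expo m α ((u + u) * H + n)) ≈ - pow R ζ (expo m α n)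
    power-flips = ≈-trans (≈-reflexive (cong (pow R ζ) expo≡))
                          (pow-shift-by-minus-one ζ (expo m α n) (u + w * (u + u))
                            (pow-odd-multiple ζ u ζᵘ≈-1 ζ²ᵘ≈1 w))

  -- For odd M with ζ^M = 1: χ changes sign and the power of ζ is unchanged.
  ψ-antiperiodic-odd : ∀ u → pow R ζ (suc (u + u)) ≈ 1# → ∀ n → ψ (suc (u + u) * H + n) ≈ - ψ n
  ψ-antiperiodic-odd u ζᴹ≈1 n with support-or-zero n
  ... | inj₁ χn≡0 = neg-zero (≈-reflexive χn≡0)
                      (≈-trans (χ-shift-odd u n) (≈-trans (-‿cong (≈-reflexive χn≡0)) -0#≈0#))
  ... | inj₂ n-odd with expo-shift-odd u n n-odd
  ...   | w , expo≡ = neg-right power-stays (χ-shift-odd u n)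
    where
    power-stays : pow R ζ (expo m α (suc (u + u) * H + n)) ≈ pow R ζ (expo m α n)
    power-stays = ≈-trans (≈-reflexive (cong (pow R ζ) expo≡))
                          (pow-shift-by-one ζ (expo m α n) (w * suc (u + u))
                            (pow-multiple ζ (suc (u + u)) ζᴹ≈1 w))

  ψ-antiperiodic : IsField R → ∀ M → RootOfUnityOfOrder R ζ M → ∀ n → ψ (M * H + n) ≈ - ψ n
  ψ-antiperiodic isField M ζ-order with evenOdd M
  ... | even zero    = ⊥-elim (<-irrefl refl (proj₁ ζ-order))
  ... | even (suc v) = ψ-antiperiodic-even (suc v)
                         (half-order-power isField ζ (suc v) (s≤s z≤n) ζ-order) (proj₁ (proj₂ ζ-order))
  ... | odd u        = ψ-antiperiodic-odd u (proj₁ (proj₂ ζ-order))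

lemma5p2 : {c ℓ : Level} (R : CommutativeRing c ℓ) → CharZero R → IsField R →
    (m α M : ℕ) → 0 < m → α < m →
    (ζ h : CommutativeRing.Carrier R) → RootOfUnityOfOrder R ζ M →
    CommutativeRing._≈_ R (CommutativeRing._*_ R h (natR R 2)) (CommutativeRing.1# R) →
    CommutativeRing._≈_ R (sum1to R (psi R h ζ m α) (M * modulus m)) (CommutativeRing.0# R)
lemma5p2 R _ isField m α M _ α<m ζ h ζ-order _ with m≤n⇒∃[o]m+o≡n α<m
... | a , refl = begin
  sum1to R ψ (M * N)          ≡⟨ cong (sum1to R ψ) M*N≡MH+MH ⟩
  sum1to R ψ (M * H + M * H)  ≈⟨ antiperiodic-sum R ψ (M * H) (ψ-antiperiodic isField M ζ-order) ⟩
  0#                          ∎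
  where
  open Residues α a using (N; H; N≡H+H)
  open Summand R ζ h α a using (ψ; ψ-antiperiodic)
  open RingFacts using (antiperiodic-sum)
  open CommutativeRing R using (0#; setoid)
  open import Relation.Binary.Reasoning.Setoid setoid
  M*N≡MH+MH : M * N ≡ M * H + M * H
  M*N≡MH+MH = trans (cong (M *_) N≡H+H) (ℕₚ.*-distribˡ-+ M H H)
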